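{- Let $k\ge 2$. Starting from a fixed ordering of a deck of $2^k$ cards, at least $(k+1)2^k$ different arrangements of the deck can be obtained by applying sequences of in and out horseshoe shuffles.
   Context: Positions in a deck of $2n$ cards are labeled $0,1,\ldots,2n-1$ from top to bottom. The out horseshoe shuffle: for $0\le j\le n-1$, the new position $2j$ receives the card previously at position $j$ and the new position $2j+1$ receives the card previously at position $2n-1-j$. The in horseshoe shuffle: for $0\le j\le n-1$, the new position $2j$ receives the card previously at position $2n-1-j$ and the new position $2j+1$ receives the card previously at position $j$. Here $2n=2^k$. -}

module Defs where

open import Data.Nat using (ℕ; _<_; _≡ᵇ_)
open import Data.Nat.DivMod using (_/_; _%_; m/n≤m)
open import Data.Nat.Properties using (≤-<-trans)
open import Data.Fin using (Fin; toℕ; fromℕ<; opposite)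
open import Data.Fin.Properties using (toℕ<n)
open import Data.Vec using (Vec; tabulate; lookup)
open import Data.List using (List; []; _∷_)
open import Data.Bool using (if_then_else_)

-- A deck of m cards: positions 0..m-1 (top to bottom); an arrangement
-- assigns to each position the card (label in Fin m) lying there.
Deck : ℕ → Set
Deck m = Vec (Fin m) m

half< : ∀ {m} (p : Fin m) → toℕ p / 2 < m
half< p = ≤-<-trans (m/n≤m (toℕ p) 2) (toℕ<n p)

half : ∀ {m} → Fin m → Fin m
half p = fromℕ< (half< p)

-- For a new position p (deck size m = 2n), the old position whose card moves to p.
-- Out: 2j ← j, 2j+1 ← 2n-1-j.   In: 2j ← 2n-1-j, 2j+1 ← j.
-- (opposite j = m - 1 - j)
outSrc : ∀ {m} → Fin m → Fin m
outSrc p = if (toℕ p % 2) ≡ᵇ 0 then half p else opposite (half p)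

inSrc : ∀ {m} → Fin m → Fin m
inSrc p = if (toℕ p % 2) ≡ᵇ 0 then opposite (half p) else half p

data Shuffle : Set where
  outS inS : Shuffle

src : ∀ {m} → Shuffle → Fin m → Fin m
src outS = outSrc
src inS  = inSrc

apply : ∀ {m} → Shuffle → Deck m → Deck m
apply s d = tabulate (λ p → lookup d (src s p))

applySeq : ∀ {m} → List Shuffle → Deck m → Deck m
applySeq []       d = d
applySeq (s ∷ ss) d = applySeq ss (apply s d)

module Submission where

-- Write N = 2^k = 2n with n = 2^(k-1) and let O, I be the maps sending a new
-- position to the old position whose card lands there (outSrc, inSrc); a deck
-- obtained from the sorted deck shows at position p the card O(...(p)).
-- We exhibit (k+1)·2^k pairwise distinct reachable decks, indexed by a word
-- b ∈ {out,in}^k and a number a ≤ k: the deck produced by  out · b · out^a.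
--  * O and I are injective (O sends even positions to the top half and odd
--    ones to the bottom half; I is O followed by the reflection p ↦ N-1-p).
--  * Position 0 is fixed by O, and O(x)=2e implies O(O x)=e, O(I x)=n+e.
--    Hence the card at position 0 of the deck for (b,a) is the binary value
--    of b (in = 1, out = 0), which recovers b.
--  * The O-orbit of position n is n, n/2, ..., 2, 1, N-1: k+1 distinct
--    positions.  Since the shuffles of b act injectively, the card at
--    position n recovers a once b is known.

open import Defs
open import Data.Nat using (ℕ; zero; suc; _≤_; _<_; _*_; _+_; _^_; _∸_; _≡ᵇ_; z≤n; s≤s)
open import Data.Nat.Properties
open import Data.Nat.DivMod using (_/_; _%_; /-congˡ; %-congˡ; m*n/n≡m; m*n%n≡0; [m+kn]%n≡m%n; +-distrib-/-∣ʳ)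
open import Data.Nat.Divisibility using (m∣m*n)
open import Data.Nat.Tactic.RingSolver using (solve-∀)
open import Data.Bool using (Bool; true; false; if_then_else_)
open import Data.Fin using (Fin; toℕ; fromℕ<; opposite)
open import Data.Fin.Properties using (toℕ-fromℕ<; toℕ-injective; toℕ<n; opposite-prop; opposite-involutive)
open import Data.Vec using (Vec; []; _∷_; toList; allFin; lookup)
open import Data.Vec.Properties using (lookup∘tabulate; lookup-allFin; ∷-injective)
open import Data.List using (List; []; _∷_; _++_; length; replicate; map; cartesianProductWith)
import Data.List as List
open import Data.List.Properties using (length-++; length-map; length-tabulate)
open import Data.List.Relation.Unary.All using (All; []; _∷_)
import Data.List.Relation.Unary.All.Properties as All
open import Data.List.Relation.Unary.AllPairs using ([]; _∷_)
open import Data.List.Relation.Unary.Unique.Propositional using (Unique)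
open import Data.List.Relation.Unary.Unique.Propositional.Properties using (cartesianProductWith⁺; allFin⁺)
open import Data.Product using (Σ; _×_; ∃; ∃-syntax; _,_)
open import Data.Sum using (_⊎_; inj₁; inj₂)
open import Function using (_∘_)
open import Relation.Nullary using (contradiction)
open import Relation.Binary.Definitions using (tri<; tri≈; tri>)
open import Relation.Binary.PropositionalEquality
  using (_≡_; refl; sym; trans; cong; cong₂; subst; subst₂; setoid; module ≡-Reasoning)
open ≡-Reasoning

parity : ∀ x → ∃[ e ] (x ≡ 2 * e ⊎ x ≡ suc (2 * e))
parity zero = 0 , inj₁ refl
parity (suc x) with parity x
... | e , inj₁ x≡ = e , inj₂ (cong suc x≡)
... | e , inj₂ x≡ = suc e , inj₁ (trans (cong suc x≡) (sym (*-suc 2 e)))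

2*n≡n+n : ∀ n → 2 * n ≡ n + n
2*n≡n+n n = cong (n +_) (+-identityʳ n)

even%2 : ∀ e → 2 * e % 2 ≡ 0
even%2 e = trans (%-congˡ (*-comm 2 e)) (m*n%n≡0 e 2)

odd%2 : ∀ e → suc (2 * e) % 2 ≡ 1
odd%2 e = trans (%-congˡ {o = 2} (cong suc (*-comm 2 e))) ([m+kn]%n≡m%n 1 e 2)

even/2 : ∀ e → 2 * e / 2 ≡ e
even/2 e = trans (/-congˡ (*-comm 2 e)) (m*n/n≡m e 2)

odd/2 : ∀ e → suc (2 * e) / 2 ≡ e
odd/2 e = trans (+-distrib-/-∣ʳ 1 (m∣m*n {2} e)) (even/2 e)

∸-intro : ∀ {a b c} → a ≡ b + c → a ∸ b ≡ c
∸-intro {b = b} {c} a≡ = trans (cong (_∸ b) a≡) (m+n∸m≡n b c)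

mirror-even : ∀ {e n} → e < n → 2 * n ∸ suc (2 * e) ≡ suc (2 * (n ∸ suc e))
mirror-even {e} {n} e<n = ∸-intro {b = suc (2 * e)} (begin
    2 * n                      ≡⟨ cong (2 *_) (sym (m+[n∸m]≡n e<n)) ⟩
    2 * (suc e + d)            ≡⟨ regroup e d ⟩
    suc (2 * e) + suc (2 * d)  ∎)
  where
    d = n ∸ suc e
    regroup : ∀ e d → 2 * (suc e + d) ≡ suc (2 * e) + suc (2 * d)
    regroup = solve-∀

mirror-fold : ∀ {e n} → e < n → 2 * n ∸ suc (n ∸ suc e) ≡ n + e
mirror-fold {e} {n} e<n = ∸-intro {b = suc (n ∸ suc e)} (begin
    2 * n            ≡⟨ 2*n≡n+n n ⟩
    n + n            ≡⟨ cong (n +_) (sym (m+[n∸m]≡n e<n)) ⟩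
    n + (suc e + d)  ≡⟨ regroup n e d ⟩
    suc d + (n + e)  ∎)
  where
    d = n ∸ suc e
    regroup : ∀ n e d → n + (suc e + d) ≡ suc d + (n + e)
    regroup = solve-∀

2^-injective : ∀ {a b} → 2 ^ a ≡ 2 ^ b → a ≡ b
2^-injective {a} {b} eq with <-cmp a b
... | tri< a<b _ _ = contradiction eq (<⇒≢ (^-monoʳ-< 2 (s≤s (s≤s z≤n)) a<b))
... | tri≈ _ a≡b _ = a≡b
... | tri> _ _ b<a = contradiction (sym eq) (<⇒≢ (^-monoʳ-< 2 (s≤s (s≤s z≤n)) b<a))

if-zero : ∀ {A : Set} {b : ℕ} (x y : A) → b ≡ 0 → (if b ≡ᵇ 0 then x else y) ≡ x
if-zero x y refl = refl

if-one : ∀ {A : Set} {b : ℕ} (x y : A) → b ≡ 1 → (if b ≡ᵇ 0 then x else y) ≡ y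
if-one x y refl = refl

toℕ-half : ∀ {m} (p : Fin m) → toℕ (half p) ≡ toℕ p / 2
toℕ-half p = toℕ-fromℕ< (half< p)

outSrc-even : ∀ {m} (p : Fin m) e → toℕ p ≡ 2 * e → toℕ (outSrc p) ≡ e
outSrc-even p e p≡ = begin
  toℕ (outSrc p)  ≡⟨ cong toℕ (if-zero (half p) (opposite (half p)) (trans (%-congˡ p≡) (even%2 e))) ⟩
  toℕ (half p)    ≡⟨ toℕ-half p ⟩
  toℕ p / 2       ≡⟨ /-congˡ p≡ ⟩
  2 * e / 2       ≡⟨ even/2 e ⟩
  e               ∎

outSrc-odd : ∀ {m} (p : Fin m) e → toℕ p ≡ suc (2 * e) → toℕ (outSrc p) ≡ m ∸ suc e
outSrc-odd {m} p e p≡ = begin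
  toℕ (outSrc p)              ≡⟨ cong toℕ (if-one (half p) (opposite (half p)) (trans (%-congˡ p≡) (odd%2 e))) ⟩
  toℕ (opposite (half p))     ≡⟨ opposite-prop (half p) ⟩
  m ∸ suc (toℕ (half p))      ≡⟨ cong (λ x → m ∸ suc x) (trans (toℕ-half p) (/-congˡ p≡)) ⟩
  m ∸ suc (suc (2 * e) / 2)   ≡⟨ cong (λ x → m ∸ suc x) (odd/2 e) ⟩
  m ∸ suc e                   ∎

inSrc-opposite : ∀ {m} (p : Fin m) → inSrc p ≡ opposite (outSrc p)
inSrc-opposite p = swap-branches (toℕ p % 2 ≡ᵇ 0) (half p)
  where
    swap-branches : ∀ {m} (b : Bool) (x : Fin m) →
                    (if b then opposite x else x) ≡ opposite (if b then x else opposite x)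
    swap-branches true  x = refl
    swap-branches false x = sym (opposite-involutive x)

opposite-injective : ∀ {m} {p q : Fin m} → opposite p ≡ opposite q → p ≡ q
opposite-injective {p = p} {q} eq = begin
  p                       ≡⟨ sym (opposite-involutive p) ⟩
  opposite (opposite p)   ≡⟨ cong opposite eq ⟩
  opposite (opposite q)   ≡⟨ opposite-involutive q ⟩
  q                       ∎

half-bound : ∀ n e (p : Fin (2 * n)) → 2 * e ≤ toℕ p → e < n
half-bound n e p 2e≤p = *-cancelˡ-< 2 e n (≤-<-trans 2e≤p (toℕ<n p))

outSrc-even-< : ∀ n e (p : Fin (2 * n)) → toℕ p ≡ 2 * e → toℕ (outSrc p) < n
outSrc-even-< n e p p≡ = subst (_< n) (sym (outSrc-even p e p≡)) (half-bound n e p (≤-reflexive (sym p≡)))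

outSrc-odd-≥ : ∀ n e (p : Fin (2 * n)) → toℕ p ≡ suc (2 * e) → n ≤ toℕ (outSrc p)
outSrc-odd-≥ n e p p≡ = subst (n ≤_) (sym (outSrc-odd p e p≡)) (m+n≤o⇒m≤o∸n n n+1+e≤2n)
  where
    e<n : e < n
    e<n = half-bound n e p (≤-trans (n≤1+n _) (≤-reflexive (sym p≡)))
    n+1+e≤2n : n + suc e ≤ 2 * n
    n+1+e≤2n = subst (n + suc e ≤_) (sym (2*n≡n+n n)) (+-monoʳ-≤ n e<n)

-- Distinct positions take their cards from distinct positions: equal sources
-- force equal parity (by the two lemmas above) and then equal halves.
outSrc-injective : ∀ n {p q : Fin (2 * n)} → outSrc p ≡ outSrc q → p ≡ q
outSrc-injective n {p} {q} eq with parity (toℕ p) | parity (toℕ q)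
... | e , inj₁ p≡ | e' , inj₁ q≡ = toℕ-injective (begin
  toℕ p   ≡⟨ p≡ ⟩
  2 * e   ≡⟨ cong (2 *_) (trans (sym (outSrc-even p e p≡)) (trans (cong toℕ eq) (outSrc-even q e' q≡))) ⟩
  2 * e'  ≡⟨ sym q≡ ⟩
  toℕ q   ∎)
... | e , inj₂ p≡ | e' , inj₂ q≡ = toℕ-injective (begin
  toℕ p         ≡⟨ p≡ ⟩
  suc (2 * e)   ≡⟨ cong (λ x → suc (2 * x)) e≡e' ⟩
  suc (2 * e')  ≡⟨ sym q≡ ⟩
  toℕ q         ∎)
  where
    bound : ∀ x (r : Fin (2 * n)) → toℕ r ≡ suc (2 * x) → suc x ≤ 2 * n
    bound x r r≡ = ≤-trans (half-bound n x r (≤-trans (n≤1+n _) (≤-reflexive (sym r≡)))) (m≤n*m n 2)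
    e≡e' : e ≡ e'
    e≡e' = suc-injective (∸-cancelˡ-≡ (bound e p p≡) (bound e' q q≡)
             (trans (sym (outSrc-odd p e p≡)) (trans (cong toℕ eq) (outSrc-odd q e' q≡))))
... | e , inj₁ p≡ | e' , inj₂ q≡ =
  contradiction (outSrc-odd-≥ n e' q q≡) (<⇒≱ (subst (_< n) (cong toℕ eq) (outSrc-even-< n e p p≡)))
... | e , inj₂ p≡ | e' , inj₁ q≡ =
  contradiction (outSrc-odd-≥ n e p p≡) (<⇒≱ (subst (_< n) (cong toℕ (sym eq)) (outSrc-even-< n e' q q≡)))

src-injective : ∀ n s {p q : Fin (2 * n)} → src s p ≡ src s q → p ≡ q
src-injective n outS eq = outSrc-injective n eq
src-injective n inS {p} {q} eq = outSrc-injective n (opposite-injective (begin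
  opposite (outSrc p)  ≡⟨ sym (inSrc-opposite p) ⟩
  inSrc p              ≡⟨ eq ⟩
  inSrc q              ≡⟨ inSrc-opposite q ⟩
  opposite (outSrc q)  ∎))

source : ∀ {m} → List Shuffle → Fin m → Fin m
source []       p = p
source (s ∷ ss) p = src s (source ss p)

lookup-applySeq : ∀ {m} ss (d : Deck m) p → lookup (applySeq ss d) p ≡ lookup d (source ss p)
lookup-applySeq []       d p = refl
lookup-applySeq (s ∷ ss) d p = trans (lookup-applySeq ss (apply s d) p) (lookup∘tabulate _ (source ss p))

source-++ : ∀ {m} xs ys (p : Fin m) → source (xs ++ ys) p ≡ source xs (source ys p)
source-++ []       ys p = refl
source-++ (x ∷ xs) ys p = cong (src x) (source-++ xs ys p)

source-injective : ∀ n ss {p q : Fin (2 * n)} → source ss p ≡ source ss q → p ≡ q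
source-injective n []       eq = eq
source-injective n (s ∷ ss) eq = source-injective n ss (src-injective n s eq)

outs : ∀ {m} → ℕ → Fin m → Fin m
outs a = source (replicate a outS)

outs-halves : ∀ {m} a y (p : Fin m) → toℕ p ≡ 2 ^ a * y → toℕ (outs a p) ≡ y
outs-halves zero    y p p≡ = trans p≡ (+-identityʳ y)
outs-halves (suc a) y p p≡ = outSrc-even (outs a p) y (outs-halves a (2 * y) p (trans p≡ regroup))
  where
    regroup : 2 * 2 ^ a * y ≡ 2 ^ a * (2 * y)
    regroup = trans (cong (_* y) (*-comm 2 (2 ^ a))) (*-assoc (2 ^ a) 2 y)

offset : Shuffle → ℕ → ℕ
offset outS _ = 0
offset inS  x = x

offset-≤ : ∀ s x → offset s x ≤ x
offset-≤ outS x = z≤n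
offset-≤ inS  x = ≤-refl

offset-* : ∀ s c x → offset s (c * x) ≡ c * offset s x
offset-* outS c x = sym (*-zeroʳ c)
offset-* inS  c x = refl

outSrc-opposite-even : ∀ n e (x : Fin (2 * n)) → toℕ x ≡ 2 * e →
                       toℕ (outSrc (opposite x)) ≡ n + e
outSrc-opposite-even n e x x≡ = begin
  toℕ (outSrc (opposite x))  ≡⟨ outSrc-odd (opposite x) (n ∸ suc e) opposite≡ ⟩
  2 * n ∸ suc (n ∸ suc e)    ≡⟨ mirror-fold e<n ⟩
  n + e                      ∎
  where
    e<n : e < n
    e<n = half-bound n e x (≤-reflexive (sym x≡))
    opposite≡ : toℕ (opposite x) ≡ suc (2 * (n ∸ suc e))
    opposite≡ = trans (opposite-prop x) (trans (cong (λ y → 2 * n ∸ suc y) x≡) (mirror-even e<n))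

trace-step : ∀ n e s (q : Fin (2 * n)) → toℕ (outSrc q) ≡ 2 * e →
             toℕ (outSrc (src s q)) ≡ offset s n + e
trace-step n e outS q q≡ = outSrc-even (outSrc q) e q≡
trace-step n e inS  q q≡ = trans (cong (toℕ ∘ outSrc) (inSrc-opposite q)) (outSrc-opposite-even n e (outSrc q) q≡)

value : ∀ {m} → Vec Shuffle m → ℕ
value []              = 0
value {suc m} (s ∷ b) = offset s (2 ^ m) + value b

value< : ∀ {m} (b : Vec Shuffle m) → value b < 2 ^ m
value< []              = s≤s z≤n
value< {suc m} (s ∷ b) =
  subst (value (s ∷ b) <_) (sym (2*n≡n+n (2 ^ m))) (+-mono-≤-< (offset-≤ s (2 ^ m)) (value< b))

value-injective : ∀ {m} (b b' : Vec Shuffle m) → value b ≡ value b' → b ≡ b'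
value-injective []         []          _  = refl
value-injective (outS ∷ b) (outS ∷ b') eq = cong (outS ∷_) (value-injective b b' eq)
value-injective {suc m} (inS ∷ b) (inS ∷ b') eq =
  cong (inS ∷_) (value-injective b b' (+-cancelˡ-≡ (2 ^ m) _ _ eq))
value-injective {suc m} (outS ∷ b) (inS ∷ b') eq =
  contradiction (subst (2 ^ m ≤_) (sym eq) (m≤m+n (2 ^ m) (value b'))) (<⇒≱ (value< b))
value-injective {suc m} (inS ∷ b) (outS ∷ b') eq =
  contradiction (subst (2 ^ m ≤_) eq (m≤m+n (2 ^ m) (value b))) (<⇒≱ (value< b'))

allWords : (m : ℕ) → List (Vec Shuffle m)
allWords zero    = [] ∷ []
allWords (suc m) = cartesianProductWith _∷_ (outS ∷ inS ∷ []) (allWords m)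

length-cartesianProductWith : ∀ {A B C : Set} (f : A → B → C) xs ys →
                              length (cartesianProductWith f xs ys) ≡ length xs * length ys
length-cartesianProductWith f []       ys = refl
length-cartesianProductWith f (x ∷ xs) ys = begin
  length (map (f x) ys ++ cartesianProductWith f xs ys)  ≡⟨ length-++ (map (f x) ys) ⟩
  length (map (f x) ys) + length (cartesianProductWith f xs ys)
    ≡⟨ cong₂ _+_ (length-map (f x) ys) (length-cartesianProductWith f xs ys) ⟩
  length ys + length xs * length ys                      ∎

allWords-length : ∀ m → length (allWords m) ≡ 2 ^ m
allWords-length zero    = refl
allWords-length (suc m) =
  trans (length-cartesianProductWith _∷_ (outS ∷ inS ∷ []) (allWords m)) (cong (2 *_) (allWords-length m))

allWords-unique : ∀ m → Unique (allWords m)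
allWords-unique zero    = [] ∷ []
allWords-unique (suc m) =
  cartesianProductWith⁺ _∷_ ∷-injective (((λ ()) ∷ []) ∷ [] ∷ []) (allWords-unique m)

-- Decks of N = 2n = 2^(h+1) cards, where words have length k = h + 1.
module Horseshoe (h : ℕ) where

  n N : ℕ
  n = 2 ^ h
  N = 2 * n

  n<N : n < N
  n<N = subst (n <_) (sym (2*n≡n+n n)) (m<m+n n (m^n>0 2 h))

  first middle : Fin N
  first  = fromℕ< (≤-<-trans z≤n n<N)
  middle = fromℕ< n<N

  trace : ∀ {m} (b : Vec Shuffle m) r → r + m ≡ suc h → (q : Fin N) → toℕ q ≡ 0 →
          toℕ (outSrc (source (toList b) q)) ≡ 2 ^ r * value b
  trace []              r _     q q≡0 = trans (outSrc-even q 0 q≡0) (sym (*-zeroʳ (2 ^ r)))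
  trace {suc m} (s ∷ b) r r+m≡ q q≡0 = begin
      toℕ (outSrc (src s (source (toList b) q)))
        ≡⟨ trace-step n (2 ^ r * value b) s _ (trans (trace b (suc r) r+m≡′ q q≡0) (*-assoc 2 (2 ^ r) (value b))) ⟩
      offset s n + 2 ^ r * value b                 ≡⟨ cong (λ x → offset s x + 2 ^ r * value b) (sym split) ⟩
      offset s (2 ^ r * 2 ^ m) + 2 ^ r * value b   ≡⟨ cong (_+ 2 ^ r * value b) (offset-* s (2 ^ r) (2 ^ m)) ⟩
      2 ^ r * offset s (2 ^ m) + 2 ^ r * value b   ≡⟨ sym (*-distribˡ-+ (2 ^ r) (offset s (2 ^ m)) (value b)) ⟩
      2 ^ r * value (s ∷ b)                        ∎
    where
      r+m≡′ : suc r + m ≡ suc h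
      r+m≡′ = trans (sym (+-suc r m)) r+m≡
      split : 2 ^ r * 2 ^ m ≡ n
      split = trans (sym (^-distribˡ-+-* 2 r m)) (cong (2 ^_) (suc-injective r+m≡′))

  orbit-halving : ∀ {a} → a ≤ h → toℕ (outs a middle) ≡ 2 ^ (h ∸ a)
  orbit-halving {a} a≤h = outs-halves a (2 ^ (h ∸ a)) middle (begin
    toℕ middle           ≡⟨ toℕ-fromℕ< n<N ⟩
    2 ^ h                ≡⟨ cong (2 ^_) (sym (m+[n∸m]≡n a≤h)) ⟩
    2 ^ (a + (h ∸ a))    ≡⟨ ^-distribˡ-+-* 2 a (h ∸ a) ⟩
    2 ^ a * 2 ^ (h ∸ a)  ∎)

  orbit-end : toℕ (outs (suc h) middle) ≡ N ∸ 1
  orbit-end = outSrc-odd (outs h middle) 0 (trans (orbit-halving ≤-refl) (cong (2 ^_) (n∸n≡0 h)))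

  orbit-halving-< : 1 ≤ h → ∀ {a} → a ≤ h → toℕ (outs a middle) < toℕ (outs (suc h) middle)
  orbit-halving-< 1≤h {a} a≤h = subst₂ _<_ (sym (orbit-halving a≤h)) (sym orbit-end)
    (≤-<-trans (^-monoʳ-≤ 2 (m∸n≤m h a)) (m+n≤o⇒m≤o∸n (suc n) 2+n≤N))
    where
      2+n≤N : suc n + 1 ≤ N
      2+n≤N = subst₂ _≤_ (+-comm 1 (suc n)) (sym (2*n≡n+n n)) (+-monoˡ-≤ n (^-monoʳ-≤ 2 1≤h))

  orbit-injective : 1 ≤ h → ∀ {a a'} → a ≤ suc h → a' ≤ suc h →
                    toℕ (outs a middle) ≡ toℕ (outs a' middle) → a ≡ a'
  orbit-injective 1≤h a≤ a'≤ eq with m≤n⇒m<n∨m≡n a≤ | m≤n⇒m<n∨m≡n a'≤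
  ... | inj₁ a< | inj₁ a'< =
    ∸-cancelˡ-≡ (≤-pred a<) (≤-pred a'<)
      (2^-injective (trans (sym (orbit-halving (≤-pred a<))) (trans eq (orbit-halving (≤-pred a'<)))))
  ... | inj₂ refl | inj₂ refl = refl
  ... | inj₁ a< | inj₂ refl = contradiction eq (<⇒≢ (orbit-halving-< 1≤h (≤-pred a<)))
  ... | inj₂ refl | inj₁ a'< = contradiction (sym eq) (<⇒≢ (orbit-halving-< 1≤h (≤-pred a'<)))

  shuffles : Vec Shuffle (suc h) → Fin (suc (suc h)) → List Shuffle
  shuffles b a = outS ∷ toList b ++ replicate (toℕ a) outS

  deck : Vec Shuffle (suc h) → Fin (suc (suc h)) → Deck N
  deck b a = applySeq (shuffles b a) (allFin N)

  lookup-deck : ∀ b a p → lookup (deck b a) p ≡ outSrc (source (toList b) (outs (toℕ a) p))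
  lookup-deck b a p = begin
    lookup (deck b a) p                                          ≡⟨ lookup-applySeq (shuffles b a) (allFin N) p ⟩
    lookup (allFin N) (source (shuffles b a) p)                  ≡⟨ lookup-allFin _ ⟩
    outSrc (source (toList b ++ replicate (toℕ a) outS) p)       ≡⟨ cong outSrc (source-++ (toList b) _ p) ⟩
    outSrc (source (toList b) (outs (toℕ a) p))                  ∎

  deck-first : ∀ b a → toℕ (lookup (deck b a) first) ≡ value b
  deck-first b a = begin
    toℕ (lookup (deck b a) first)                        ≡⟨ cong toℕ (lookup-deck b a first) ⟩
    toℕ (outSrc (source (toList b) (outs (toℕ a) first)))  ≡⟨ trace b 0 refl _ (outs-halves (toℕ a) 0 first first≡) ⟩
    1 * value b                                          ≡⟨ *-identityˡ (value b) ⟩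
    value b                                              ∎
    where
      first≡ : toℕ first ≡ 2 ^ toℕ a * 0
      first≡ = trans (toℕ-fromℕ< _) (sym (*-zeroʳ (2 ^ toℕ a)))

  deck-middle : 1 ≤ h → ∀ b {a a'} → deck b a ≡ deck b a' → a ≡ a'
  deck-middle 1≤h b {a} {a'} eq =
    toℕ-injective (orbit-injective 1≤h (bound a) (bound a') (cong toℕ same-source))
    where
      bound : (x : Fin (suc (suc h))) → toℕ x ≤ suc h
      bound x = ≤-pred (toℕ<n x)
      same-source : outs (toℕ a) middle ≡ outs (toℕ a') middle
      same-source = source-injective n (toList b) (outSrc-injective n (begin
        outSrc (source (toList b) (outs (toℕ a) middle))   ≡⟨ sym (lookup-deck b a middle) ⟩
        lookup (deck b a) middle                           ≡⟨ cong (λ d → lookup d middle) eq ⟩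
        lookup (deck b a') middle                          ≡⟨ lookup-deck b a' middle ⟩
        outSrc (source (toList b) (outs (toℕ a') middle))  ∎))

  deck-injective : 1 ≤ h → ∀ {b a b' a'} → deck b a ≡ deck b' a' → b ≡ b' × a ≡ a'
  deck-injective 1≤h {b} {a} {b'} {a'} eq
    with value-injective b b' (trans (sym (deck-first b a))
                                (trans (cong (λ d → toℕ (lookup d first)) eq) (deck-first b' a')))
  ... | refl = refl , deck-middle 1≤h b eq

  decks : List (Deck N)
  decks = cartesianProductWith deck (allWords (suc h)) (List.allFin (suc (suc h)))

  decks-length : length decks ≡ 2 ^ suc h * suc (suc h)
  decks-length = trans (length-cartesianProductWith deck (allWords (suc h)) (List.allFin (suc (suc h))))
                       (cong₂ _*_ (allWords-length (suc h)) (length-tabulate {n = suc (suc h)} (λ x → x)))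

  decks-unique : 1 ≤ h → Unique decks
  decks-unique 1≤h = cartesianProductWith⁺ deck (deck-injective 1≤h) (allWords-unique (suc h)) (allFin⁺ (suc (suc h)))

  decks-reachable : All (λ d → ∃ (λ ss → d ≡ applySeq ss (allFin N))) decks
  decks-reachable = All.cartesianProductWith⁺ (setoid _) (setoid _) deck (allWords (suc h))
                      (List.allFin (suc (suc h))) (λ {b} {a} _ _ → shuffles b a , refl)

proposition2 : (k : ℕ) → 2 ≤ k →
    Σ (List (Deck (2 ^ k))) (λ ds →
      ((k + 1) * 2 ^ k ≤ length ds)
      × Unique ds
      × All (λ d → ∃ (λ ss → d ≡ applySeq ss (allFin (2 ^ k)))) ds)
proposition2 zero ()
proposition2 k@(suc h) (s≤s 1≤h) = decks , count , decks-unique 1≤h , decks-reachable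
  where
    open Horseshoe h
    count : (k + 1) * 2 ^ k ≤ length decks
    count = ≤-reflexive (begin
      (k + 1) * 2 ^ k  ≡⟨ cong (_* 2 ^ k) (+-comm k 1) ⟩
      suc k * 2 ^ k    ≡⟨ *-comm (suc k) (2 ^ k) ⟩
      2 ^ k * suc k    ≡⟨ decks-length ⟨
      length decks     ∎)
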